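{- For every positive integer $n=p_1^{\alpha_1}\cdots p_m^{\alpha_m}$ (prime factorization with distinct primes $p_i$), $$rb(\mathbb{Z}_n,1) \geq 2+\sum_{i=1}^{m} \alpha_i\big(rb(\mathbb{Z}_{p_i},1)-2\big).$$
   Context: $\mathbb{Z}_n$ denotes the cyclic group of order $n$. An $r$-coloring of $\mathbb{Z}_n$ is a surjective map $c:\mathbb{Z}_n\to\{1,\dots,r\}$. For a fixed integer $k$, a triple is any $(x_1,x_2,x_3)\in\mathbb{Z}_n^3$ with $x_1+x_2\equiv kx_3 \pmod n$. A triple is rainbow under $c$ if $c(x_1),c(x_2),c(x_3)$ are pairwise distinct; $c$ is rainbow-free if no triple is rainbow. The rainbow number $rb(\mathbb{Z}_n,k)$ is the smallest positive integer $r$ such that every $r$-coloring of $\mathbb{Z}_n$ admits a rainbow triple (by convention $rb(\mathbb{Z}_n,k)=n+1$ if no such $r$ exists). -}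

module Defs where

open import Data.Nat using (ℕ; zero; suc; _+_; _*_; _^_; _≤_; _<_)
open import Data.Fin using (Fin; toℕ) renaming (zero to fzero; suc to fsuc)
open import Data.Integer as ℤ using (ℤ; +_)
open import Data.Integer.Divisibility using () renaming (_∣_ to _∣ℤ_)
open import Data.Product using (Σ; ∃; _×_; _,_)
open import Data.Sum using (_⊎_)
open import Relation.Nullary using (¬_)
open import Relation.Binary.PropositionalEquality using (_≡_; _≢_)

-- ℤ_n is represented by Fin n (residues 0..n-1).
-- An r-coloring of ℤ_n: a surjective map Fin n → Fin r (colors 1..r ↦ Fin r).
Surj : {n r : ℕ} → (Fin n → Fin r) → Set
Surj {n} {r} c = (y : Fin r) → ∃ λ x → c x ≡ y

IsTriple : (n : ℕ) → ℤ → Fin n → Fin n → Fin n → Set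
IsTriple n k x₁ x₂ x₃ =
  (+ n) ∣ℤ ((+ toℕ x₁ ℤ.+ + toℕ x₂) ℤ.- (k ℤ.* + toℕ x₃))

Rainbow : {n r : ℕ} → (Fin n → Fin r) → Fin n → Fin n → Fin n → Set
Rainbow c x₁ x₂ x₃ = (c x₁ ≢ c x₂) × (c x₁ ≢ c x₃) × (c x₂ ≢ c x₃)

HasRainbowTriple : (n : ℕ) → ℤ → {r : ℕ} → (Fin n → Fin r) → Set
HasRainbowTriple n k c =
  Σ (Fin n) λ x₁ → Σ (Fin n) λ x₂ → Σ (Fin n) λ x₃ →
    IsTriple n k x₁ x₂ x₃ × Rainbow c x₁ x₂ x₃

AllColoringsRainbow : ℕ → ℤ → ℕ → Set
AllColoringsRainbow n k r =
  (c : Fin n → Fin r) → Surj c → HasRainbowTriple n k c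

-- IsRb n k r : r = rb(ℤ_n, k), i.e. r is the smallest positive integer such that
-- every r-coloring admits a rainbow triple, with the convention r = n+1 when
-- no r ∈ {1,…,n} has this property.
IsRb : ℕ → ℤ → ℕ → Set
IsRb n k r =
  ( (1 ≤ r) × (r ≤ n) × AllColoringsRainbow n k r
      × ((s : ℕ) → 1 ≤ s → s < r → ¬ AllColoringsRainbow n k s) )
  ⊎
  ( (r ≡ suc n)
      × ((s : ℕ) → 1 ≤ s → s ≤ n → ¬ AllColoringsRainbow n k s) )

∑ : (m : ℕ) → (Fin m → ℕ) → ℕ
∑ zero    f = 0
∑ (suc m) f = f fzero + ∑ m (λ i → f (fsuc i))

∏ : (m : ℕ) → (Fin m → ℕ) → ℕ
∏ zero    f = 1
∏ (suc m) f = f fzero * ∏ m (λ i → f (fsuc i))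

module Submission where

-- Call a rainbow-free colouring of
-- ℤ_m that exhibits K + 1 distinct colours, one of them at 0, a witness for
-- rb(ℤ_m,1) ≥ K + 2 (record RainbowFree).  The proof has three parts.
--  1. Residues: arithmetic of Schur triples x + y = z in ℤ_m, including how a
--     triple of ℤ_(N·M) splits into a triple of ℤ_M and, when the remainders
--     cancel, a triple of ℤ_N, and the five triples derived from x + y = z by
--     negation.
--  2. Product: witnesses for ℤ_N (A + 1 colours) and ℤ_M (B + 1 colours)
--     combine into one for ℤ_(N·M) with A + B + 1 colours.  Multiples of M are
--     coloured through ℤ_N, all other residues through a symmetrised version of
--     the colouring of ℤ_M (constant on ±x), with disjoint palettes.
--     Iterating over n = ∏ pᵢ^αᵢ gives 1 + ∑ αᵢ·(rb(ℤ_pᵢ,1) − 2) colours.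
--  3. Link with rb: minimality of rb(ℤ_p,1) gives (under double negation,
--     harmless since the goal is decidable) a witness with rb(ℤ_p,1) − 1
--     colours, and a witness with K + 1 colours forces rb(ℤ_n,1) ≥ K + 2.

open import Defs

module Residues where
  open import Data.Nat as ℕ using (ℕ; zero; suc)
  import Data.Nat.Properties as ℕP
  import Data.Nat.Divisibility as ℕD
  open import Data.Fin as Fin using (Fin; toℕ; combine) renaming (zero to fzero; suc to fsuc)
  import Data.Fin.Properties as FinP
  open import Data.Integer using (ℤ; +_; _+_; _-_; _*_; ∣_∣; _⊖_)
  import Data.Integer.Properties as ℤP
  open import Data.Integer.Divisibility.Signed using (_∣_; divides; ∣ᵤ⇒∣; ∣⇒∣ᵤ;
    ∣m∣n⇒∣m+n; ∣m∣n⇒∣m-n; ∣m+n∣m⇒∣n; ∣m⇒∣m*n; ∣-refl; ∣-trans; *-cancelʳ-∣)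
  open import Data.Integer.Tactic.RingSolver using (solve-∀)
  open import Data.Sum using (_⊎_; inj₁; inj₂)
  open import Relation.Binary.PropositionalEquality
  open import Relation.Nullary using (contradiction)
  open ≡-Reasoning

  ι : ∀ {m} → Fin m → ℤ
  ι x = + toℕ x

  Schur : (m : ℕ) → Fin m → Fin m → Fin m → Set
  Schur m x y z = + m ∣ ι x + ι y - ι z

  isTriple⇒Schur : ∀ {m} (x y z : Fin m) → IsTriple m (+ 1) x y z → Schur m x y z
  isTriple⇒Schur {m} x y z t =
    subst (λ v → + m ∣ ι x + ι y - v) (ℤP.*-identityˡ (ι z)) (∣ᵤ⇒∣ t)

  Schur⇒isTriple : ∀ {m} (x y z : Fin m) → Schur m x y z → IsTriple m (+ 1) x y z
  Schur⇒isTriple {m} x y z t =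
    ∣⇒∣ᵤ (subst (λ v → + m ∣ ι x + ι y - v) (sym (ℤP.*-identityˡ (ι z))) t)

  ExactSum : ∀ {m} → Fin m → Fin m → Fin m → Set
  ExactSum x y z = ι x + ι y - ι z ≡ + 0

  multiple-gap : ∀ {m u v} → u ℕ.≤ v → v ℕ.< m → m ℕD.∣ ∣ u ⊖ v ∣ → u ≡ v
  multiple-gap {m} {u} {v} u≤v v<m m∣gap =
    ℕP.≤-antisym u≤v (ℕP.m∸n≡0⇒m≤n (small (ℕP.≤-<-trans (ℕP.m∸n≤m v u) v<m)
                                            (subst (m ℕD.∣_) (ℤP.∣⊖∣-≤ u≤v) m∣gap)))
    where
    small : ∀ {d} → d ℕ.< m → m ℕD.∣ d → d ≡ 0
    small {zero}  _   _   = refl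
    small {suc d} d<m m∣d = contradiction m∣d (ℕD.>⇒∤ d<m)

  residue-injective : ∀ {m} (x y : Fin m) → + m ∣ ι x - ι y → x ≡ y
  residue-injective {m} x y m∣x-y = FinP.toℕ-injective (by-order (ℕP.≤-total (toℕ x) (toℕ y)))
    where
    m∣gap : m ℕD.∣ ∣ toℕ x ⊖ toℕ y ∣
    m∣gap = subst (λ v → m ℕD.∣ ∣ v ∣) (ℤP.[+m]-[+n]≡m⊖n (toℕ x) (toℕ y)) (∣⇒∣ᵤ m∣x-y)

    by-order : toℕ x ℕ.≤ toℕ y ⊎ toℕ y ℕ.≤ toℕ x → toℕ x ≡ toℕ y
    by-order (inj₁ x≤y) = multiple-gap x≤y (FinP.toℕ<n y) m∣gap
    by-order (inj₂ y≤x) = sym (multiple-gap y≤x (FinP.toℕ<n x)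
                            (subst (m ℕD.∣_) (ℤP.∣m⊖n∣≡∣n⊖m∣ (toℕ x) (toℕ y)) m∣gap))

  neg : ∀ {k} → Fin (suc k) → Fin (suc k)
  neg fzero    = fzero
  neg (fsuc i) = fsuc (Fin.opposite i)

  neg-involutive : ∀ {k} (x : Fin (suc k)) → neg (neg x) ≡ x
  neg-involutive fzero    = refl
  neg-involutive (fsuc i) = cong fsuc (FinP.opposite-involutive i)

  neg-inverse : ∀ {k} (x : Fin (suc k)) → + suc k ∣ ι (neg x) + ι x
  neg-inverse fzero    = divides (+ 0) refl
  neg-inverse {k} (fsuc i) = divides (+ 1) (cong +_ (begin
    suc (toℕ (Fin.opposite i)) ℕ.+ suc (toℕ i)
      ≡⟨ cong (λ v → suc v ℕ.+ suc (toℕ i)) (FinP.opposite-prop i) ⟩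
    suc (k ℕ.∸ suc (toℕ i)) ℕ.+ suc (toℕ i)    ≡⟨ cong suc (ℕP.m∸n+n≡m (FinP.toℕ<n i)) ⟩
    suc k                                      ≡⟨ ℕP.+-identityʳ (suc k) ⟨
    1 ℕ.* suc k                                ∎))

  module _ {k : ℕ} where
    private
      p : ℕ
      p = suc k

      via : ∀ {a b} → a ≡ b → + p ∣ b → + p ∣ a
      via a≡b = subst (+ p ∣_) (sym a≡b)

    schur-zeroˡ : ∀ (y z : Fin p) → Schur p fzero y z → y ≡ z
    schur-zeroˡ y z t = residue-injective y z (via (cong (_- ι z) (sym (ℤP.+-identityˡ (ι y)))) t)

    schur-zeroʳ : ∀ (x z : Fin p) → Schur p x fzero z → x ≡ z
    schur-zeroʳ x z t = residue-injective x z (via (cong (_- ι z) (sym (ℤP.+-identityʳ (ι x)))) t)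

    schur-sum-zero : ∀ (x y : Fin p) → Schur p x y fzero → y ≡ neg x
    schur-sum-zero x y t = residue-injective y (neg x) (via (identity (ι x) (ι y) (ι (neg x)))
                                                            (∣m∣n⇒∣m-n t (neg-inverse x)))
      where
      identity : ∀ a b a' → b - a' ≡ (a + b - + 0) - (a' + a)
      identity = solve-∀

    schur-inverse : ∀ (x : Fin p) → Schur p x (neg x) fzero
    schur-inverse x = via (identity (ι x) (ι (neg x))) (neg-inverse x)
      where
      identity : ∀ a a' → a + a' - + 0 ≡ a' + a
      identity = solve-∀

    -- The five further triples obtained from x + y = z by negating and moving
    -- terms across the equation.  They are what makes the symmetrised colouring
    -- below rainbow-free.
    -- (−x) + (−y) = −z
    schur-negate : ∀ (x y z : Fin p) → Schur p x y z → Schur p (neg x) (neg y) (neg z)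
    schur-negate x y z t = via (identity (ι x) (ι y) (ι z) (ι (neg x)) (ι (neg y)) (ι (neg z)))
      (∣m∣n⇒∣m-n (∣m∣n⇒∣m-n (∣m∣n⇒∣m+n (neg-inverse x) (neg-inverse y)) (neg-inverse z)) t)
      where
      identity : ∀ a b c a' b' c' → a' + b' - c' ≡ ((a' + a) + (b' + b) - (c' + c)) - (a + b - c)
      identity = solve-∀

    schur-z-y : ∀ (x y z : Fin p) → Schur p x y z → Schur p z (neg y) x
    schur-z-y x y z t = via (identity (ι x) (ι y) (ι z) (ι (neg y))) (∣m∣n⇒∣m-n (neg-inverse y) t)
      where
      identity : ∀ a b c b' → c + b' - a ≡ (b' + b) - (a + b - c)
      identity = solve-∀

    schur-z-x : ∀ (x y z : Fin p) → Schur p x y z → Schur p z (neg x) y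
    schur-z-x x y z t = via (identity (ι x) (ι y) (ι z) (ι (neg x))) (∣m∣n⇒∣m-n (neg-inverse x) t)
      where
      identity : ∀ a b c a' → c + a' - b ≡ (a' + a) - (a + b - c)
      identity = solve-∀

    schur-x-z : ∀ (x y z : Fin p) → Schur p x y z → Schur p (neg z) x (neg y)
    schur-x-z x y z t = via (identity (ι x) (ι y) (ι z) (ι (neg y)) (ι (neg z)))
      (∣m∣n⇒∣m+n (∣m∣n⇒∣m-n (neg-inverse z) (neg-inverse y)) t)
      where
      identity : ∀ a b c b' c' → c' + a - b' ≡ ((c' + c) - (b' + b)) + (a + b - c)
      identity = solve-∀

    schur-y-z : ∀ (x y z : Fin p) → Schur p x y z → Schur p (neg z) y (neg x)
    schur-y-z x y z t = via (identity (ι x) (ι y) (ι z) (ι (neg x)) (ι (neg z)))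
      (∣m∣n⇒∣m+n (∣m∣n⇒∣m-n (neg-inverse z) (neg-inverse x)) t)
      where
      identity : ∀ a b c a' c' → c' + b - a' ≡ ((c' + c) - (a' + a)) + (a + b - c)
      identity = solve-∀

  ι-combine : ∀ {N M} (h : Fin N) (r : Fin M) → ι (combine h r) ≡ + M * ι h + ι r
  ι-combine {N} {M} h r = begin
    + toℕ (combine h r)               ≡⟨ cong +_ (FinP.toℕ-combine h r) ⟩
    + (M ℕ.* toℕ h ℕ.+ toℕ r)         ≡⟨ ℤP.pos-+ (M ℕ.* toℕ h) (toℕ r) ⟩
    + (M ℕ.* toℕ h) + ι r             ≡⟨ cong (_+ ι r) (ℤP.pos-* M (toℕ h)) ⟩
    + M * ι h + ι r                   ∎

  ι-split : ∀ {N} M (x : Fin (N ℕ.* M)) →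
            ι x ≡ + M * ι (Fin.quotient {N} M x) + ι (Fin.remainder {N} M x)
  ι-split {N} M x = trans (cong ι (sym (FinP.combine-remQuot {N} M x)))
                          (ι-combine (Fin.quotient {N} M x) (Fin.remainder {N} M x))

  module _ {N k : ℕ} where
    private
      M : ℕ
      M = suc k
      q : Fin (N ℕ.* M) → Fin N
      q = Fin.quotient {N} M
      r : Fin (N ℕ.* M) → Fin M
      r = Fin.remainder {N} M

      split-sum : ∀ x y z → ι x + ι y - ι z ≡
                  + M * (ι (q x) + ι (q y) - ι (q z)) + (ι (r x) + ι (r y) - ι (r z))
      split-sum x y z = begin
        ι x + ι y - ι z
          ≡⟨ cong₂ (λ s c → s - c) (cong₂ _+_ (ι-split {N} M x) (ι-split {N} M y)) (ι-split {N} M z) ⟩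
        (+ M * ι (q x) + ι (r x)) + (+ M * ι (q y) + ι (r y)) - (+ M * ι (q z) + ι (r z))
          ≡⟨ identity (+ M) (ι (q x)) (ι (q y)) (ι (q z)) (ι (r x)) (ι (r y)) (ι (r z)) ⟩
        + M * (ι (q x) + ι (q y) - ι (q z)) + (ι (r x) + ι (r y) - ι (r z)) ∎
        where
        identity : ∀ m a b c u v w →
                   (m * a + u) + (m * b + v) - (m * c + w) ≡ m * (a + b - c) + (u + v - w)
        identity = solve-∀

      M∣N*M : + M ∣ + (N ℕ.* M)
      M∣N*M = divides (+ N) (ℤP.pos-* N M)

    schur-remainder : ∀ x y z → Schur (N ℕ.* M) x y z → Schur M (r x) (r y) (r z)
    schur-remainder x y z t = ∣m+n∣m⇒∣n (subst (+ M ∣_) (split-sum x y z) (∣-trans M∣N*M t))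
                                        (∣m⇒∣m*n (ι (q x) + ι (q y) - ι (q z)) ∣-refl)

    schur-quotient : ∀ x y z → Schur (N ℕ.* M) x y z →
                     ExactSum (r x) (r y) (r z) → Schur N (q x) (q y) (q z)
    schur-quotient x y z t cancel = *-cancelʳ-∣ (+ M) (subst₂ _∣_ (ℤP.pos-* N M) multiple t)
      where
      quotients : ℤ
      quotients = ι (q x) + ι (q y) - ι (q z)
      multiple : ι x + ι y - ι z ≡ quotients * + M
      multiple = begin
        ι x + ι y - ι z                                 ≡⟨ split-sum x y z ⟩
        + M * quotients + (ι (r x) + ι (r y) - ι (r z)) ≡⟨ cong (_+_ (+ M * quotients)) cancel ⟩
        + M * quotients + + 0                           ≡⟨ ℤP.+-identityʳ _ ⟩
        + M * quotients                                 ≡⟨ ℤP.*-comm (+ M) quotients ⟩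
        quotients * + M                                 ∎

open Residues

open import Data.Nat using (ℕ; zero; suc; _+_; _*_; _∸_; _^_; _≤_; s≤s; z≤n)
import Data.Nat.Properties as ℕP
import Data.Nat.Divisibility as ℕD
open import Data.Nat.Primality using (Prime; ¬prime[0])
open import Data.Fin as Fin using (Fin; toℕ; combine; remQuot; splitAt; join; punchIn)
  renaming (zero to fzero; suc to fsuc)
import Data.Fin.Properties as FinP
open import Data.Integer using (+_)
open import Data.Product using (_×_; _,_; proj₁; proj₂; uncurry)
open import Data.Sum using (_⊎_; inj₁; inj₂)
open import Effect.Monad using (RawMonad)
open import Function using (_∘′_)
open import Function.Definitions using (Injective)
open import Level using (0ℓ)
open import Relation.Binary.Definitions using (DecidableEquality)
open import Relation.Binary.PropositionalEquality
  using (_≡_; _≢_; refl; sym; trans; cong; subst; module ≡-Reasoning)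
open import Relation.Nullary using (¬_; yes; no; Dec; contradiction)
open import Relation.Nullary.Decidable using (decidable-stable; _×-dec_; ¬?)
open import Relation.Nullary.Negation using (¬¬-Monad)

Rainbow₃ : {A : Set} → A → A → A → Set
Rainbow₃ a b c = (a ≢ b) × (a ≢ c) × (b ≢ c)

rainbow-swap₁₃ : ∀ {A : Set} {a b c : A} → Rainbow₃ a b c → Rainbow₃ c b a
rainbow-swap₁₃ (a≢b , a≢c , b≢c) = (λ e → b≢c (sym e)) , (λ e → a≢c (sym e)) , (λ e → a≢b (sym e))

rainbow-swap₂₃ : ∀ {A : Set} {a b c : A} → Rainbow₃ a b c → Rainbow₃ a c b
rainbow-swap₂₃ (a≢b , a≢c , b≢c) = a≢c , a≢b , (λ e → b≢c (sym e))

module Prefer {A : Set} (_≟_ : DecidableEquality A) (a : A) where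

  prefer : A → A → A
  prefer u v with u ≟ a
  ... | yes _ = v
  ... | no  _ = u

  prefer-≢ : ∀ {u} v → u ≢ a → prefer u v ≡ u
  prefer-≢ {u} v u≢a with u ≟ a
  ... | yes u≡a = contradiction u≡a u≢a
  ... | no  _   = refl

  prefer-comm : ∀ u v → ¬ Rainbow₃ u v a → prefer u v ≡ prefer v u
  prefer-comm u v not-rainbow with u ≟ a | v ≟ a
  ... | yes u≡a | yes v≡a = trans v≡a (sym u≡a)
  ... | yes _   | no  _   = refl
  ... | no  _   | yes _   = refl
  ... | no  u≢a | no  v≢a with u ≟ v
  ...   | yes u≡v = u≡v
  ...   | no  u≢v = contradiction (u≢v , u≢a , v≢a) not-rainbow

  prefer-not-rainbow : ∀ u₁ u₂ u₃ v₁ v₂ v₃ →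
    ¬ Rainbow₃ u₁ u₂ u₃ → ¬ Rainbow₃ v₁ v₂ v₃ → ¬ Rainbow₃ u₃ v₂ u₁ →
    ¬ Rainbow₃ u₃ v₁ u₂ → ¬ Rainbow₃ v₃ u₁ v₂ → ¬ Rainbow₃ v₃ u₂ v₁ →
    ¬ Rainbow₃ (prefer u₁ v₁) (prefer u₂ v₂) (prefer u₃ v₃)
  prefer-not-rainbow u₁ u₂ u₃ v₁ v₂ v₃ t₁ t₂ t₃ t₄ t₅ t₆ with u₁ ≟ a | u₂ ≟ a | u₃ ≟ a
  ... | no  _   | no  _   | no  _   = t₁
  ... | yes _   | yes _   | yes _   = t₂
  ... | no  _   | yes _   | no  _   = t₃ ∘′ rainbow-swap₁₃
  ... | yes _   | no  _   | no  _   = t₄ ∘′ rainbow-swap₂₃ ∘′ rainbow-swap₁₃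
  ... | no  _   | yes _   | yes _   = t₅ ∘′ rainbow-swap₂₃ ∘′ rainbow-swap₁₃
  ... | yes _   | no  _   | yes _   = t₆ ∘′ rainbow-swap₁₃
  ... | no  u₁≢a | no  u₂≢a | yes u₃≡a = λ (u₁≢u₂ , _ , _) →
        t₁ (u₁≢u₂ , (λ e → u₁≢a (trans e u₃≡a)) , (λ e → u₂≢a (trans e u₃≡a)))
  ... | yes u₁≡a | yes u₂≡a | no  u₃≢a = both-negatives
    where
    -- the colours are v₁, v₂, u₃; one of v₁, v₂ differs from a = u₁ = u₂
    both-negatives : ¬ Rainbow₃ v₁ v₂ u₃
    both-negatives (v₁≢v₂ , v₁≢u₃ , v₂≢u₃) with v₁ ≟ a | v₂ ≟ a
    ... | no v₁≢a | _ =
          t₄ ((λ e → v₁≢u₃ (sym e)) , (λ e → u₃≢a (trans e u₂≡a)) , (λ e → v₁≢a (trans e u₂≡a)))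
    ... | yes _   | no v₂≢a =
          t₃ ((λ e → v₂≢u₃ (sym e)) , (λ e → u₃≢a (trans e u₁≡a)) , (λ e → v₂≢a (trans e u₁≡a)))
    ... | yes v₁≡a | yes v₂≡a = v₁≢v₂ (trans v₁≡a (sym v₂≡a))

equal₁₂ : ∀ {A : Set} {a b c : A} → a ≡ b → ¬ Rainbow₃ a b c
equal₁₂ a≡b (a≢b , _ , _) = a≢b a≡b

equal₁₃ : ∀ {A : Set} {a b c : A} → a ≡ c → ¬ Rainbow₃ a b c
equal₁₃ a≡c (_ , a≢c , _) = a≢c a≡c

equal₂₃ : ∀ {A : Set} {a b c : A} → b ≡ c → ¬ Rainbow₃ a b c
equal₂₃ b≡c (_ , _ , b≢c) = b≢c b≡c

not-rainbow-map : ∀ {A B : Set} (f : A → B) {a b c : A} →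
                  ¬ Rainbow₃ a b c → ¬ Rainbow₃ (f a) (f b) (f c)
not-rainbow-map f not-rainbow (fa≢fb , fa≢fc , fb≢fc) =
  not-rainbow ((λ e → fa≢fb (cong f e)) , (λ e → fa≢fc (cong f e)) , (λ e → fb≢fc (cong f e)))

module Symmetrise {k : ℕ} (c : Fin (suc k) → ℕ)
                  (no-rainbow : ∀ x y z → Schur (suc k) x y z → ¬ Rainbow₃ (c x) (c y) (c z)) where
  open Prefer ℕP._≟_ (c fzero)

  sym-colour : Fin (suc k) → ℕ
  sym-colour x = prefer (c x) (c (neg x))

  sym-colour-neg : ∀ x → sym-colour x ≡ sym-colour (neg x)
  sym-colour-neg x = trans (prefer-comm (c x) (c (neg x))
                                         (no-rainbow x (neg x) fzero (schur-inverse x)))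
                           (cong (λ y → prefer (c (neg x)) (c y)) (sym (neg-involutive x)))

  sym-colour-≢ : ∀ {x} → c x ≢ c fzero → sym-colour x ≡ c x
  sym-colour-≢ {x} = prefer-≢ (c (neg x))

  sym-colour-no-rainbow : ∀ x y z → Schur (suc k) x y z →
                          ¬ Rainbow₃ (sym-colour x) (sym-colour y) (sym-colour z)
  sym-colour-no-rainbow x y z t =
    prefer-not-rainbow (c x) (c y) (c z) (c (neg x)) (c (neg y)) (c (neg z))
      (no-rainbow _ _ _ t) (no-rainbow _ _ _ (schur-negate x y z t))
      (no-rainbow _ _ _ (schur-z-y x y z t)) (no-rainbow _ _ _ (schur-z-x x y z t))
      (no-rainbow _ _ _ (schur-x-z x y z t)) (no-rainbow _ _ _ (schur-y-z x y z t))

-- A rainbow-free colouring of ℤ_m exhibiting K + 1 distinct colours, the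
-- first of them at the residue 0.  Its existence means rb(ℤ_m,1) ≥ K + 2.
record RainbowFree (m K : ℕ) : Set where
  field
    colour       : Fin m → ℕ
    no-rainbow   : ∀ x y z → Schur m x y z → ¬ Rainbow₃ (colour x) (colour y) (colour z)
    witness      : Fin (suc K) → Fin m
    witness-zero : toℕ (witness fzero) ≡ 0
    distinct     : ∀ i j → colour (witness i) ≡ colour (witness j) → i ≡ j

monochromatic : ∀ {k} → RainbowFree (suc k) 0
monochromatic = record
  { colour       = λ _ → 0
  ; no-rainbow   = λ _ _ _ _ → equal₁₂ refl
  ; witness      = λ _ → fzero
  ; witness-zero = refl
  ; distinct     = λ { fzero fzero _ → refl }
  }

restrict : ∀ {m K K′} → K′ ≤ K → RainbowFree m K → RainbowFree m K′
restrict K′≤K C = record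
  { colour       = colour
  ; no-rainbow   = no-rainbow
  ; witness      = λ i → witness (Fin.inject≤ i (s≤s K′≤K))
  ; witness-zero = witness-zero
  ; distinct     = λ i j e → FinP.inject≤-injective _ _ i j (distinct _ _ e)
  }
  where open RainbowFree C

-- Colours of the two factors are kept apart by parity.
even odd : ℕ → ℕ
even c = 2 * c
odd  c = suc (2 * c)

even-injective : ∀ {a b} → even a ≡ even b → a ≡ b
even-injective {a} {b} = ℕP.*-cancelˡ-≡ a b 2

odd-injective : ∀ {a b} → odd a ≡ odd b → a ≡ b
odd-injective = even-injective ∘′ ℕP.suc-injective

splitAt-injective : ∀ m {n} (i j : Fin (m + n)) → splitAt m i ≡ splitAt m j → i ≡ j
splitAt-injective m {n} i j e = begin
  i                      ≡⟨ FinP.join-splitAt m n i ⟨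
  join m n (splitAt m i) ≡⟨ cong (join m n) e ⟩
  join m n (splitAt m j) ≡⟨ FinP.join-splitAt m n j ⟩
  j                      ∎
  where open ≡-Reasoning

-- A triple
-- reduces modulo M to a triple of ℤ_M; if all its remainders vanish it is a
-- triple of ℤ_N, if exactly two do not they are equal or opposite, otherwise
-- the symmetrised colouring of ℤ_M is rainbow-free.
module Product {N k A B : ℕ} (H : RainbowFree N A) (Q : RainbowFree (suc k) B) where
  private
    M : ℕ
    M = suc k
    module H = RainbowFree H
    module Q = RainbowFree Q
  open Symmetrise Q.colour Q.no-rainbow

  colour-parts : Fin N → Fin M → ℕ
  colour-parts h fzero    = even (H.colour h)
  colour-parts h (fsuc i) = odd (sym-colour (fsuc i))

  colour : Fin (N * M) → ℕ
  colour x = uncurry colour-parts (remQuot M x)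

  colour-combine : ∀ h r → colour (combine h r) ≡ colour-parts h r
  colour-combine h r = cong (uncurry colour-parts) (FinP.remQuot-combine h r)

  parts-no-rainbow : ∀ h₁ h₂ h₃ r₁ r₂ r₃ → Schur M r₁ r₂ r₃ →
    (ExactSum r₁ r₂ r₃ → Schur N h₁ h₂ h₃) →
    ¬ Rainbow₃ (colour-parts h₁ r₁) (colour-parts h₂ r₂) (colour-parts h₃ r₃)
  parts-no-rainbow h₁ h₂ h₃ fzero fzero fzero _ quotient-triple =
    not-rainbow-map even (H.no-rainbow h₁ h₂ h₃ (quotient-triple refl))
  parts-no-rainbow _ _ _ fzero fzero (fsuc i) t _ with () ← schur-zeroˡ fzero (fsuc i) t
  parts-no-rainbow _ _ _ fzero (fsuc i) fzero t _ with () ← schur-zeroˡ (fsuc i) fzero t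
  parts-no-rainbow _ _ _ (fsuc i) fzero fzero t _ with () ← schur-zeroʳ (fsuc i) fzero t
  parts-no-rainbow _ h₂ _ fzero (fsuc i) (fsuc j) t _ =
    equal₂₃ (cong (colour-parts h₂) (schur-zeroˡ (fsuc i) (fsuc j) t))
  parts-no-rainbow h₁ _ _ (fsuc i) fzero (fsuc j) t _ =
    equal₁₃ (cong (colour-parts h₁) (schur-zeroʳ (fsuc i) (fsuc j) t))
  parts-no-rainbow _ _ _ (fsuc i) (fsuc j) fzero t _ =
    equal₁₂ (cong odd (trans (sym-colour-neg (fsuc i))
                             (cong sym-colour (sym (schur-sum-zero (fsuc i) (fsuc j) t)))))
  parts-no-rainbow _ _ _ (fsuc i) (fsuc j) (fsuc l) t _ =
    not-rainbow-map odd (sym-colour-no-rainbow (fsuc i) (fsuc j) (fsuc l) t)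

  no-rainbow : ∀ x y z → Schur (N * M) x y z → ¬ Rainbow₃ (colour x) (colour y) (colour z)
  no-rainbow x y z t = parts-no-rainbow (q x) (q y) (q z) (r x) (r y) (r z)
                         (schur-remainder {N} x y z t) (schur-quotient {N} x y z t)
    where
    q : Fin (N * M) → Fin N
    q = Fin.quotient {N} M
    r : Fin (N * M) → Fin M
    r = Fin.remainder {N} M

  Q-zero : Q.witness fzero ≡ fzero
  Q-zero = FinP.toℕ-injective Q.witness-zero

  Q-colour-≢ : ∀ j → Q.colour (Q.witness (fsuc j)) ≢ Q.colour fzero
  Q-colour-≢ j e with () ← Q.distinct (fsuc j) fzero (trans e (cong Q.colour (sym Q-zero)))

  colour-parts-Q : ∀ h r → Q.colour r ≢ Q.colour fzero → colour-parts h r ≡ odd (Q.colour r)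
  colour-parts-Q h fzero    r≢0 = contradiction refl r≢0
  colour-parts-Q h (fsuc i) r≢0 = cong odd (sym-colour-≢ r≢0)

  embed : Fin (suc A) ⊎ Fin B → Fin (N * M)
  embed (inj₁ i) = combine (H.witness i) fzero
  embed (inj₂ j) = combine (H.witness fzero) (Q.witness (fsuc j))

  colour-embed-H : ∀ i → colour (embed (inj₁ i)) ≡ even (H.colour (H.witness i))
  colour-embed-H i = colour-combine (H.witness i) fzero

  colour-embed-Q : ∀ j → colour (embed (inj₂ j)) ≡ odd (Q.colour (Q.witness (fsuc j)))
  colour-embed-Q j = trans (colour-combine _ _) (colour-parts-Q _ _ (Q-colour-≢ j))

  embed-distinct : ∀ s t → colour (embed s) ≡ colour (embed t) → s ≡ t
  embed-distinct (inj₁ i) (inj₁ i′) e = cong inj₁ (H.distinct i i′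
    (even-injective (trans (sym (colour-embed-H i)) (trans e (colour-embed-H i′)))))
  embed-distinct (inj₁ i) (inj₂ j) e = contradiction
    (trans (sym (colour-embed-H i)) (trans e (colour-embed-Q j)))
    (ℕP.even≢odd (H.colour (H.witness i)) (Q.colour (Q.witness (fsuc j))))
  embed-distinct (inj₂ j) (inj₁ i) e = contradiction
    (trans (sym (colour-embed-H i)) (trans (sym e) (colour-embed-Q j)))
    (ℕP.even≢odd (H.colour (H.witness i)) (Q.colour (Q.witness (fsuc j))))
  embed-distinct (inj₂ j) (inj₂ j′) e = cong inj₂ (FinP.suc-injective (Q.distinct (fsuc j) (fsuc j′)
    (odd-injective (trans (sym (colour-embed-Q j)) (trans e (colour-embed-Q j′))))))

  rainbowFree : RainbowFree (N * M) (A + B)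
  rainbowFree = record
    { colour       = colour
    ; no-rainbow   = no-rainbow
    ; witness      = embed ∘′ splitAt (suc A)
    ; witness-zero = begin
        toℕ (combine (H.witness fzero) (fzero {k}))  ≡⟨ FinP.toℕ-combine (H.witness fzero) fzero ⟩
        M * toℕ (H.witness fzero) + 0               ≡⟨ cong (λ v → M * v + 0) H.witness-zero ⟩
        M * 0 + 0                                   ≡⟨ cong (_+ 0) (ℕP.*-zeroʳ M) ⟩
        0                                           ∎
    ; distinct     = λ i j e → splitAt-injective (suc A) i j
                                   (embed-distinct (splitAt (suc A) i) (splitAt (suc A) j) e)
    }
    where open ≡-Reasoning

-- The product construction for an arbitrary second factor (ℤ_0 carries none).
product : ∀ {N M A B} → RainbowFree N A → RainbowFree M B → RainbowFree (N * M) (A + B)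
product {M = zero}  _ Q with () ← RainbowFree.witness Q fzero
product {M = suc k} H Q = Product.rainbowFree H Q

power : ∀ {p B} → RainbowFree p B → ∀ a → RainbowFree (p ^ a) (a * B)
power P zero    = monochromatic
power P (suc a) = product P (power P a)

prime-power-product : ∀ m (p α B : Fin m → ℕ) → (∀ i → RainbowFree (p i) (B i)) →
  RainbowFree (∏ m (λ i → p i ^ α i)) (∑ m (λ i → α i * B i))
prime-power-product zero    p α B P = monochromatic
prime-power-product (suc m) p α B P = product (power (P fzero) (α fzero))
  (prime-power-product m (p ∘′ fsuc) (α ∘′ fsuc) (B ∘′ fsuc) (λ i → P (fsuc i)))

-- Reasoning under double negation (all our goals are decidable).
open RawMonad (¬¬-Monad {0ℓ}) using (pure; _>>=_)

¬¬-shift : ∀ m {P : Fin m → Set} → (∀ i → ¬ ¬ P i) → ¬ ¬ (∀ i → P i)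
¬¬-shift zero    _   = pure λ ()
¬¬-shift (suc m) ¬¬P = do
  P₀ ← ¬¬P fzero
  Pₛ ← ¬¬-shift m (λ i → ¬¬P (fsuc i))
  pure λ { fzero → P₀ ; (fsuc i) → Pₛ i }

rainbow? : ∀ {n s} (c : Fin n → Fin s) → Dec (HasRainbowTriple n (+ 1) c)
rainbow? c = FinP.any? λ x → FinP.any? λ y → FinP.any? λ z →
  (_ ℕD.∣? _) ×-dec ¬? (c x FinP.≟ c y) ×-dec ¬? (c x FinP.≟ c z) ×-dec ¬? (c y FinP.≟ c z)

from-colouring : ∀ {k K} (c : Fin (suc k) → Fin (suc K)) → Surj c →
                 ¬ HasRainbowTriple (suc k) (+ 1) c → RainbowFree (suc k) K
from-colouring {k} {K} c surj no-triple = record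
  { colour       = toℕ ∘′ c
  ; no-rainbow   = λ x y z t (cx≢cy , cx≢cz , cy≢cz) → no-triple (x , y , z , Schur⇒isTriple x y z t ,
                     (cx≢cy ∘′ cong toℕ) , (cx≢cz ∘′ cong toℕ) , (cy≢cz ∘′ cong toℕ))
  ; witness      = witness
  ; witness-zero = refl
  ; distinct     = λ i j e → palette-injective i j (trans (sym (c-witness i))
                             (trans (FinP.toℕ-injective e) (c-witness j)))
  }
  where
  -- an enumeration of the colours starting with the colour of 0
  palette : Fin (suc K) → Fin (suc K)
  palette fzero    = c fzero
  palette (fsuc i) = punchIn (c fzero) i

  palette-injective : ∀ i j → palette i ≡ palette j → i ≡ j
  palette-injective fzero    fzero    _ = refl
  palette-injective fzero    (fsuc j) e = contradiction (sym e) (FinP.punchInᵢ≢i (c fzero) j)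
  palette-injective (fsuc i) fzero    e = contradiction e (FinP.punchInᵢ≢i (c fzero) i)
  palette-injective (fsuc i) (fsuc j) e = cong fsuc (FinP.punchIn-injective (c fzero) i j e)

  witness : Fin (suc K) → Fin (suc k)
  witness fzero    = fzero
  witness (fsuc i) = proj₁ (surj (palette (fsuc i)))

  c-witness : ∀ i → c (witness i) ≡ palette i
  c-witness fzero    = refl
  c-witness (fsuc i) = proj₂ (surj (palette (fsuc i)))

¬all⇒rainbowFree : ∀ {k K} → ¬ AllColoringsRainbow (suc k) (+ 1) (suc K) → ¬ ¬ RainbowFree (suc k) K
¬all⇒rainbowFree ¬all ¬C = ¬all λ c surj →
  decidable-stable (rainbow? c) (λ no-triple → ¬C (from-colouring c surj no-triple))

module WitnessIndex {m K : ℕ} (C : RainbowFree m K) where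
  open RainbowFree C

  index : ℕ → Fin (suc K)
  index v with FinP.any? (λ j → colour (witness j) ℕP.≟ v)
  ... | yes (j , _) = j
  ... | no  _       = fzero

  index-witness : ∀ j → index (colour (witness j)) ≡ j
  index-witness j with FinP.any? (λ j′ → colour (witness j′) ℕP.≟ colour (witness j))
  ... | yes (j′ , e) = distinct j′ j e
  ... | no  none     = contradiction (j , refl) none

-- Conversely, a rainbow-free colouring exhibiting K + 1 colours gives a
-- surjective rainbow-free (K+1)-colouring: send each colour to the index of
-- the witness carrying it (other colours to 0); a rainbow for the new
-- colouring would be one for the old.
rainbowFree⇒¬all : ∀ {m K} → RainbowFree m K → ¬ AllColoringsRainbow m (+ 1) (suc K)
rainbowFree⇒¬all C all =
  let (x , y , z , triple , ix≢iy , ix≢iz , iy≢iz) =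
        all (index ∘′ colour) (λ j → witness j , index-witness j)
  in no-rainbow x y z (isTriple⇒Schur x y z triple)
       ((ix≢iy ∘′ cong index) , (ix≢iz ∘′ cong index) , (iy≢iz ∘′ cong index))
  where
  open RainbowFree C
  open WitnessIndex C

-- The exhibited colours sit at distinct residues, so K + 1 ≤ m.
rainbowFree⇒bound : ∀ {m K} → RainbowFree m K → suc K ≤ m
rainbowFree⇒bound C = FinP.injective⇒≤ (λ e → distinct _ _ (cong colour e))
  where open RainbowFree C

rb-lower-bound : ∀ {n K r} → RainbowFree n K → IsRb n (+ 1) r → 2 + K ≤ r
rb-lower-bound C (inj₁ (s≤s z≤n , _ , all , _)) =
  s≤s (ℕP.≮⇒≥ λ r′<1+K → rainbowFree⇒¬all (restrict (ℕP.≤-pred r′<1+K) C) all)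
rb-lower-bound C (inj₂ (refl , _)) = s≤s (rainbowFree⇒bound C)

rb-colouring : ∀ {k r} → IsRb (suc k) (+ 1) r → ¬ ¬ RainbowFree (suc k) (r ∸ 2)
rb-colouring {r = 0} _ = pure monochromatic
rb-colouring {r = 1} _ = pure monochromatic
rb-colouring {r = 2} _ = pure monochromatic
rb-colouring {r = suc (suc (suc t))} (inj₁ (_ , _ , _ , minimal)) =
  ¬all⇒rainbowFree (minimal (suc (suc t)) (s≤s z≤n) ℕP.≤-refl)
rb-colouring {r = suc (suc (suc t))} (inj₂ (r≡1+p , minimal)) =
  ¬all⇒rainbowFree (minimal (suc (suc t)) (s≤s z≤n) (ℕP.≤-reflexive (ℕP.suc-injective r≡1+p)))

-- Primes are positive, so this applies to every ℤ_p.
prime-colouring : ∀ {p r} → Prime p → IsRb p (+ 1) r → ¬ ¬ RainbowFree p (r ∸ 2)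
prime-colouring {zero}  p-prime = contradiction p-prime ¬prime[0]
prime-colouring {suc k} _       = rb-colouring

proposition2 : (n : ℕ) → 1 ≤ n →
    (m : ℕ) (p α : Fin m → ℕ) →
    ((i : Fin m) → Prime (p i)) →
    Injective _≡_ _≡_ p →
    ((i : Fin m) → 1 ≤ α i) →
    n ≡ ∏ m (λ i → p i ^ α i) →
    (r : ℕ) → IsRb n (+ 1) r →
    (rp : Fin m → ℕ) → ((i : Fin m) → IsRb (p i) (+ 1) (rp i)) →
    2 + ∑ m (λ i → α i * (rp i ∸ 2)) ≤ r
proposition2 n _ m p α primes _ _ n≡∏ r rb rp rb-p = decidable-stable (_ ℕP.≤? r) do
  colourings ← ¬¬-shift m (λ i → prime-colouring (primes i) (rb-p i))
  let colouring = prime-power-product m p α (λ i → rp i ∸ 2) colourings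
  pure (rb-lower-bound (subst (λ N → RainbowFree N _) (sym n≡∏) colouring) rb)
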